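{- Let $G'=(A\,\dot\cup\,B,E')$ be a bipartite graph with $A=\{a_1,\dots,a_n\}$, $B=\{b_1,\dots,b_n\}$ containing no three edges of the form $(a_p,b_q),(a_{p+1},b_{q+1}),(a_{p+2},b_{q+2})$. Let $ALG$ be the consecutive matching returned by the procedure $\textsc{LocalImprovements}$ run on $G'$, and let $OPT$ be a consecutive matching of $G'$ of maximum cardinality. Let $k_1$ be the number of edges of $OPT$ that overlap with exactly one edge of $ALG$. Then $k_1\le|ALG|$.
   Context: A matching $M\subseteq E'$ is consecutive (a "valid solution") if whenever $(a_i,b_j),(a_{i+1},b_{j'})\in M$ then $j'=j+1$, and whenever $(a_i,b_j),(a_{i'},b_{j+1})\in M$ then $i'=i+1$. Two edges $(a_i,b_j)$ and $(a_{i'},b_{j'})$ overlap if $|i-i'|\le1$ or $|j-j'|\le1$ (every edge overlaps with itself). Procedure $\textsc{LocalImprovements}$: start with $ALG=\emptyset$; repeat: if there is an edge $e\notin ALG$ such that $ALG\cup\{e\}$ is a consecutive matching, add it; then, if there are edges $e_1,e_2\notin ALG$ and $e'\in ALG$ such that $(ALG\setminus\{e'\})\cup\{e_1,e_2\}$ is a consecutive matching, replace $ALG$ by it; if $|ALG|$ did not increase in this iteration, stop and return $ALG$. -}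

module Defs where

open import Data.Nat using (ℕ; suc; _≤_; _<_; ∣_-_∣; _≟_)
open import Data.Nat.Properties using (_≤?_)
open import Data.Fin using (Fin; toℕ)
open import Data.Product using (_×_; _,_; proj₁; proj₂; ∃; ∃-syntax)
open import Data.Sum using (_⊎_)
open import Data.Empty using (⊥)
open import Data.List using (List; []; _∷_; _++_; length; filter)
open import Data.List.Membership.Propositional using (_∈_; _∉_)
open import Data.List.Relation.Unary.All using (All)
open import Data.List.Relation.Unary.Unique.Propositional using (Unique)
open import Relation.Binary.PropositionalEquality using (_≡_)
open import Relation.Nullary using (¬_; Dec)
open import Relation.Nullary.Decidable using (_⊎-dec_)

-- An edge (a_i , b_j) is the pair (i , j) with i j : Fin n (0-based indices).
Edge : ℕ → Set
Edge n = Fin n × Fin n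

Graph : ℕ → Set₁
Graph n = Edge n → Set

NoThreeDiagonal : ∀ {n} → Graph n → Set
NoThreeDiagonal {n} E =
  ∀ (p q p₁ q₁ p₂ q₂ : Fin n) →
  toℕ p₁ ≡ suc (toℕ p) → toℕ p₂ ≡ suc (toℕ p₁) →
  toℕ q₁ ≡ suc (toℕ q) → toℕ q₂ ≡ suc (toℕ q₁) →
  E (p , q) → E (p₁ , q₁) → E (p₂ , q₂) → ⊥

-- A set of edges is represented by a duplicate-free list.
IsMatching : ∀ {n} → List (Edge n) → Set
IsMatching M =
  (∀ {e e'} → e ∈ M → e' ∈ M → proj₁ e ≡ proj₁ e' → e ≡ e') ×
  (∀ {e e'} → e ∈ M → e' ∈ M → proj₂ e ≡ proj₂ e' → e ≡ e')

IsConsecutive : ∀ {n} → List (Edge n) → Set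
IsConsecutive {n} M =
  (∀ (i i' j j' : Fin n) → (i , j) ∈ M → (i' , j') ∈ M →
     toℕ i' ≡ suc (toℕ i) → toℕ j' ≡ suc (toℕ j)) ×
  (∀ (i i' j j' : Fin n) → (i , j) ∈ M → (i' , j') ∈ M →
     toℕ j' ≡ suc (toℕ j) → toℕ i' ≡ suc (toℕ i))

ConsecutiveMatching : ∀ {n} → Graph n → List (Edge n) → Set
ConsecutiveMatching E M = Unique M × All E M × IsMatching M × IsConsecutive M

MaximumConsecutiveMatching : ∀ {n} → Graph n → List (Edge n) → Set
MaximumConsecutiveMatching {n} E M =
  ConsecutiveMatching E M ×
  (∀ (M' : List (Edge n)) → ConsecutiveMatching E M' → length M' ≤ length M)

Overlap : ∀ {n} → Edge n → Edge n → Set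
Overlap (i , j) (i' , j') = (∣ toℕ i - toℕ i' ∣ ≤ 1) ⊎ (∣ toℕ j - toℕ j' ∣ ≤ 1)

overlap? : ∀ {n} (e e' : Edge n) → Dec (Overlap e e')
overlap? (i , j) (i' , j') = (∣ toℕ i - toℕ i' ∣ ≤? 1) ⊎-dec (∣ toℕ j - toℕ j' ∣ ≤? 1)

overlapCount : ∀ {n} → List (Edge n) → Edge n → ℕ
overlapCount ALG e = length (filter (overlap? e) ALG)

k₁ : ∀ {n} → List (Edge n) → List (Edge n) → ℕ
k₁ ALG OPT = length (filter (λ e → overlapCount ALG e ≟ 1) OPT)

-- Procedure LocalImprovements, as a (nondeterministic) relation.
-- First half of an iteration: add an edge if possible.
data AddStep {n} (E : Graph n) (ALG : List (Edge n)) : List (Edge n) → Set where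
  add   : ∀ e → E e → e ∉ ALG → ConsecutiveMatching E (e ∷ ALG) → AddStep E ALG (e ∷ ALG)
  noAdd : (∀ e → E e → e ∉ ALG → ¬ ConsecutiveMatching E (e ∷ ALG)) → AddStep E ALG ALG


data SwapStep {n} (E : Graph n) (ALG : List (Edge n)) : List (Edge n) → Set where
  swap   : ∀ e₁ e₂ e' xs ys → E e₁ → E e₂ → e₁ ∉ ALG → e₂ ∉ ALG →
           ALG ≡ xs ++ (e' ∷ ys) → ConsecutiveMatching E (e₁ ∷ e₂ ∷ xs ++ ys) →
           SwapStep E ALG (e₁ ∷ e₂ ∷ xs ++ ys)
  noSwap : (∀ e₁ e₂ e' xs ys → E e₁ → E e₂ → e₁ ∉ ALG → e₂ ∉ ALG →
              ALG ≡ xs ++ (e' ∷ ys) → ¬ ConsecutiveMatching E (e₁ ∷ e₂ ∷ xs ++ ys)) →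
           SwapStep E ALG ALG

Iteration : ∀ {n} → Graph n → List (Edge n) → List (Edge n) → Set
Iteration {n} E ALG ALG' = ∃[ ALG₁ ] (AddStep E ALG ALG₁ × SwapStep E ALG₁ ALG')

data Reachable {n} (E : Graph n) : List (Edge n) → Set where
  start : Reachable E []
  step  : ∀ {A A'} → Reachable E A → Iteration E A A' → length A < length A' → Reachable E A'

Returns : ∀ {n} → Graph n → List (Edge n) → Set
Returns E ALG = ∃[ A ] (Reachable E A × Iteration E A ALG × length ALG ≤ length A)

-- If an edge e of OPT overlaps exactly one edge a of ALG, then e and all of ALG except a are
-- pairwise compatible, and so are two such edges with the same partner a (they lie in OPT).
-- Hence two distinct edges of OPT with the same partner would give a 2-for-1 swap, and an edge
-- of OPT whose partner also lies in OPT would be addable; local optimality of ALG forbids both.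
-- So "e overlaps only a" is injective from the edges counted by k₁ into ALG.
module Submission where

open import Defs
open import Data.Nat using (ℕ; zero; suc; _≤_; _<_; z≤n; s≤s; ∣_-_∣; _≟_)
open import Data.Nat.Properties using (∣n-n∣≡0; ∣-∣-comm; <-trans; <⇒≱; ≤-reflexive; n<1+n)
open import Data.Fin using (toℕ)
import Data.Fin.Properties as Fin
open import Data.List using (List; []; _∷_; _++_; length; filter)
open import Data.List.Properties using (length-++-sucʳ)
open import Data.List.Membership.Propositional using (_∈_; _∉_)
open import Data.List.Membership.Propositional.Properties using (∈-++⁻; ∈-∃++; ∈-filter⁻; ∈-filter⁺)
open import Data.List.Relation.Binary.Subset.Propositional using (_⊆_)
open import Data.List.Relation.Binary.Permutation.Propositional using (_↭_; ↭-sym; ↭⇒↭ₛ)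
open import Data.List.Relation.Binary.Permutation.Propositional.Properties using (shift; ∈-resp-↭; ↭-length)
import Data.List.Relation.Binary.Permutation.Setoid.Properties as Permutationₛ
open import Data.List.Relation.Unary.Any using (here; there)
open import Data.List.Relation.Unary.All as All using (All; []; _∷_)
open import Data.List.Relation.Unary.All.Properties using (¬Any⇒All¬; All¬⇒¬Any)
open import Data.List.Relation.Unary.AllPairs as AllPairs using ([]; _∷_)
open import Data.List.Relation.Unary.Unique.Propositional using (Unique)
import Data.List.Relation.Unary.Unique.Propositional.Properties as Unique
open import Data.Product using (_×_; _,_; proj₁; proj₂; ∃)
open import Data.Product.Properties using (≡-dec)
open import Data.Sum using (_⊎_; inj₁; inj₂)
open import Data.Empty using (⊥-elim)
open import Relation.Nullary using (¬_; Dec; yes; no)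
open import Relation.Unary using (Pred; Decidable)
open import Relation.Binary.PropositionalEquality
  using (_≡_; _≢_; refl; sym; trans; subst; cong; setoid)
open import Function using (_∘_)
open import Level using (0ℓ)

∈⇒↭∷ : ∀ {X : Set} {x : X} {xs} → x ∈ xs → ∃ λ rest → xs ↭ x ∷ rest
∈⇒↭∷ x∈xs with ys , zs , refl ← ∈-∃++ x∈xs = ys ++ zs , shift _ ys zs

∈-↭∷⁻ : ∀ {X : Set} {x z : X} {xs rest} → xs ↭ x ∷ rest → z ∈ xs → z ≢ x → z ∈ rest
∈-↭∷⁻ σ z∈xs z≢x with ∈-resp-↭ σ z∈xs
... | here z≡x = ⊥-elim (z≢x z≡x)
... | there z∈rest = z∈rest

Unique-resp-↭ : ∀ {X : Set} {xs ys : List X} → xs ↭ ys → Unique xs → Unique ys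
Unique-resp-↭ {X} σ = Permutationₛ.Unique-resp-↭ (setoid X) (↭⇒↭ₛ σ)

length-filter≡1⇒∃! : ∀ {X : Set} {P : Pred X 0ℓ} (P? : Decidable P) {xs} → length (filter P? xs) ≡ 1 →
                     ∃ λ a → a ∈ xs × P a × (∀ {b} → b ∈ xs → P b → b ≡ a)
length-filter≡1⇒∃! {P = P} P? {xs} len with filter P? xs in eq | len
... | a ∷ [] | refl = a , proj₁ a∈xs×Pa , proj₂ a∈xs×Pa , only
  where
  a∈xs×Pa : a ∈ xs × P a
  a∈xs×Pa = ∈-filter⁻ P? (subst (a ∈_) (sym eq) (here refl))
  only : ∀ {b} → b ∈ xs → P b → b ≡ a
  only b∈xs Pb with subst (_ ∈_) eq (∈-filter⁺ P? b∈xs Pb)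
  ... | here b≡a = b≡a

injectiveRel⇒length≤ : ∀ {X Y : Set} (R : X → Y → Set) {xs : List X} {ys : List Y} → Unique xs →
                       (∀ {x} → x ∈ xs → ∃ λ y → y ∈ ys × R x y) →
                       (∀ {x x' y} → x ∈ xs → x' ∈ xs → R x y → R x' y → x ≡ x') →
                       length xs ≤ length ys
injectiveRel⇒length≤ R {[]} _ _ _ = z≤n
injectiveRel⇒length≤ R {x ∷ xs} {ys} (x∉xs ∷ u) total injective
  with y , y∈ys , Rxy ← total (here refl)
  with rest , σ ← ∈⇒↭∷ y∈ys
  rewrite ↭-length σ = s≤s (injectiveRel⇒length≤ R u total′ (λ p q → injective (there p) (there q)))
  where
  total′ : ∀ {x'} → x' ∈ xs → ∃ λ y' → y' ∈ rest × R x' y'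
  total′ {x'} x'∈xs with y' , y'∈ys , Rx'y' ← total (there x'∈xs) =
    y' , ∈-↭∷⁻ σ y'∈ys y'≢y , Rx'y'
    where
    y'≢y : y' ≢ y
    y'≢y refl = All¬⇒¬Any x∉xs (subst (_∈ xs) (injective (there x'∈xs) (here refl) Rx'y' Rxy) x'∈xs)

∣n-n∣≤1 : ∀ n → ∣ n - n ∣ ≤ 1
∣n-n∣≤1 n rewrite ∣n-n∣≡0 n = z≤n

∣n-1+n∣≤1 : ∀ n → ∣ n - suc n ∣ ≤ 1
∣n-1+n∣≤1 zero = s≤s z≤n
∣n-1+n∣≤1 (suc n) = ∣n-1+n∣≤1 n

module _ {n : ℕ} where

  -- The pairwise conditions that IsMatching and IsConsecutive impose on two edges.
  Compatible : Edge n → Edge n → Set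
  Compatible e f = (proj₁ e ≡ proj₁ f → e ≡ f) × (proj₂ e ≡ proj₂ f → e ≡ f) ×
                   (toℕ (proj₁ f) ≡ suc (toℕ (proj₁ e)) → toℕ (proj₂ f) ≡ suc (toℕ (proj₂ e))) ×
                   (toℕ (proj₂ f) ≡ suc (toℕ (proj₂ e)) → toℕ (proj₁ f) ≡ suc (toℕ (proj₁ e)))

  overlap-refl : ∀ (e : Edge n) → Overlap e e
  overlap-refl (i , _) = inj₁ (∣n-n∣≤1 (toℕ i))

  overlap-sym : ∀ (e f : Edge n) → Overlap e f → Overlap f e
  overlap-sym (i , _) (i' , _) (inj₁ p) = inj₁ (subst (_≤ 1) (∣-∣-comm (toℕ i) (toℕ i')) p)
  overlap-sym (_ , j) (_ , j') (inj₂ p) = inj₂ (subst (_≤ 1) (∣-∣-comm (toℕ j) (toℕ j')) p)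

  ¬overlap⇒compatible : ∀ {e f : Edge n} → ¬ Overlap e f → Compatible e f
  ¬overlap⇒compatible {i , j} {i' , j'} ¬o =
    (λ { refl → ⊥-elim (¬o (inj₁ (∣n-n∣≤1 (toℕ i)))) }) ,
    (λ { refl → ⊥-elim (¬o (inj₂ (∣n-n∣≤1 (toℕ j)))) }) ,
    (λ i'≡1+i → ⊥-elim (¬o (inj₁ (subst (λ m → ∣ toℕ i - m ∣ ≤ 1) (sym i'≡1+i) (∣n-1+n∣≤1 (toℕ i)))))) ,
    (λ j'≡1+j → ⊥-elim (¬o (inj₂ (subst (λ m → ∣ toℕ j - m ∣ ≤ 1) (sym j'≡1+j) (∣n-1+n∣≤1 (toℕ j))))))

  _≟ₑ_ : (e f : Edge n) → Dec (e ≡ f)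
  _≟ₑ_ = ≡-dec Fin._≟_ Fin._≟_

  module _ {E : Graph n} where

    consecutiveMatching⇒compatible : ∀ {M} → ConsecutiveMatching E M →
                                     ∀ {e f} → e ∈ M → f ∈ M → Compatible e f
    consecutiveMatching⇒compatible (_ , _ , (row , col) , (right , down)) {i , j} {i' , j'} p q =
      row p q , col p q , right i i' j j' p q , down i i' j j' p q

    compatible⇒consecutiveMatching : ∀ {M} → Unique M → All E M →
                                     (∀ {e f} → e ∈ M → f ∈ M → Compatible e f) →
                                     ConsecutiveMatching E M
    compatible⇒consecutiveMatching u inE comp = u , inE ,
      ((λ p q → proj₁ (comp p q)) , (λ p q → proj₁ (proj₂ (comp p q)))) ,
      ((λ _ _ _ _ p q → proj₁ (proj₂ (proj₂ (comp p q)))) ,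
       (λ _ _ _ _ p q → proj₂ (proj₂ (proj₂ (comp p q)))))

    -- Non-overlapping edges are always compatible, so only overlapping pairs across S and R
    -- need a common consecutive matching, here N.
    ++-consecutiveMatching : ∀ {M N S R} → ConsecutiveMatching E M → ConsecutiveMatching E N →
                             S ⊆ N → R ⊆ M → Unique (S ++ R) →
                             (∀ {x y} → x ∈ S → y ∈ R → Overlap x y → y ∈ N) →
                             ConsecutiveMatching E (S ++ R)
    ++-consecutiveMatching {N = N} {S} {R} cmM cmN S⊆N R⊆M u overlap⇒∈N =
      compatible⇒consecutiveMatching u (All.tabulate inE) compatible
      where
      inE : ∀ {z} → z ∈ S ++ R → E z
      inE z∈ with ∈-++⁻ S z∈
      ... | inj₁ z∈S = All.lookup (proj₁ (proj₂ cmN)) (S⊆N z∈S)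
      ... | inj₂ z∈R = All.lookup (proj₁ (proj₂ cmM)) (R⊆M z∈R)

      across : ∀ {x y} → x ∈ S → y ∈ R → Compatible x y × Compatible y x
      across {x} {y} x∈S y∈R with overlap? x y
      ... | yes o = consecutiveMatching⇒compatible cmN (S⊆N x∈S) y∈N ,
                    consecutiveMatching⇒compatible cmN y∈N (S⊆N x∈S)
        where
        y∈N : y ∈ N
        y∈N = overlap⇒∈N x∈S y∈R o
      ... | no ¬o = ¬overlap⇒compatible ¬o , ¬overlap⇒compatible (¬o ∘ overlap-sym y x)

      compatible : ∀ {z w} → z ∈ S ++ R → w ∈ S ++ R → Compatible z w
      compatible z∈ w∈ with ∈-++⁻ S z∈ | ∈-++⁻ S w∈
      ... | inj₁ z∈S | inj₁ w∈S = consecutiveMatching⇒compatible cmN (S⊆N z∈S) (S⊆N w∈S)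
      ... | inj₁ z∈S | inj₂ w∈R = proj₁ (across z∈S w∈R)
      ... | inj₂ z∈R | inj₁ w∈S = proj₂ (across w∈S z∈R)
      ... | inj₂ z∈R | inj₂ w∈R = consecutiveMatching⇒compatible cmM (R⊆M z∈R) (R⊆M w∈R)

module _ {n : ℕ} (E : Graph n) where

  CannotAdd : List (Edge n) → Set
  CannotAdd ALG = ∀ e → E e → e ∉ ALG → ¬ ConsecutiveMatching E (e ∷ ALG)

  CannotSwap : List (Edge n) → Set
  CannotSwap ALG = ∀ e₁ e₂ e' xs ys → E e₁ → E e₂ → e₁ ∉ ALG → e₂ ∉ ALG →
                   ALG ≡ xs ++ (e' ∷ ys) → ¬ ConsecutiveMatching E (e₁ ∷ e₂ ∷ xs ++ ys)

  record LocallyOptimal (ALG : List (Edge n)) : Set where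
    field
      consecutive : ConsecutiveMatching E ALG
      cannotAdd   : CannotAdd ALG
      cannotSwap  : CannotSwap ALG

  addStep-stuck-or-grows : ∀ {X Y} → AddStep E X Y → (X ≡ Y × CannotAdd X) ⊎ length X < length Y
  addStep-stuck-or-grows (add _ _ _ _) = inj₂ (n<1+n _)
  addStep-stuck-or-grows (noAdd cannot) = inj₁ (refl , cannot)

  swapStep-stuck-or-grows : ∀ {X Y} → SwapStep E X Y → (X ≡ Y × CannotSwap X) ⊎ length X < length Y
  swapStep-stuck-or-grows (swap _ _ e' xs ys _ _ _ _ refl _) =
    inj₂ (≤-reflexive (cong suc (length-++-sucʳ xs e' ys)))
  swapStep-stuck-or-grows (noSwap cannot) = inj₁ (refl , cannot)

  iteration-consecutive : ∀ {X Y} → ConsecutiveMatching E X → Iteration E X Y → ConsecutiveMatching E Y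
  iteration-consecutive cm (_ , _ , swap _ _ _ _ _ _ _ _ _ _ cm″) = cm″
  iteration-consecutive cm (_ , add _ _ _ cm′ , noSwap _) = cm′
  iteration-consecutive cm (_ , noAdd _ , noSwap _) = cm

  reachable-consecutive : ∀ {X} → Reachable E X → ConsecutiveMatching E X
  reachable-consecutive start = [] , [] , ((λ ()) , (λ ())) , ((λ _ _ _ _ ()) , (λ _ _ _ _ ()))
  reachable-consecutive (step r it _) = iteration-consecutive (reachable-consecutive r) it

  nonGrowingIteration⇒stuck : ∀ {X Y} → Iteration E X Y → length Y ≤ length X →
                        X ≡ Y × CannotAdd X × CannotSwap X
  nonGrowingIteration⇒stuck (_ , add′ , swap′) Y≤X
    with addStep-stuck-or-grows add′ | swapStep-stuck-or-grows swap′
  ... | inj₁ (refl , cannotAdd) | inj₁ (refl , cannotSwap) = refl , cannotAdd , cannotSwap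
  ... | inj₁ (refl , _) | inj₂ X<Y = ⊥-elim (<⇒≱ X<Y Y≤X)
  ... | inj₂ X<Z | inj₁ (refl , _) = ⊥-elim (<⇒≱ X<Z Y≤X)
  ... | inj₂ X<Z | inj₂ Z<Y = ⊥-elim (<⇒≱ (<-trans X<Z Z<Y) Y≤X)

  returns⇒locallyOptimal : ∀ {ALG} → Returns E ALG → LocallyOptimal ALG
  returns⇒locallyOptimal (_ , reach , it , ALG≤A) with nonGrowingIteration⇒stuck it ALG≤A
  ... | refl , cannotAdd , cannotSwap = record
    { consecutive = reachable-consecutive reach ; cannotAdd = cannotAdd ; cannotSwap = cannotSwap }

UniqueOverlap : ∀ {n} → List (Edge n) → Edge n → Edge n → Set
UniqueOverlap ALG e a = a ∈ ALG × Overlap e a × (∀ {b} → b ∈ ALG → Overlap e b → b ≡ a)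

module _ {n : ℕ} {E : Graph n} {ALG OPT : List (Edge n)}
         (optimal : LocallyOptimal E ALG) (cmOPT : ConsecutiveMatching E OPT) where

  open LocallyOptimal optimal

  private
    ∈OPT⇒E : ∀ {e} → e ∈ OPT → E e
    ∈OPT⇒E = All.lookup (proj₁ (proj₂ cmOPT))

  uniqueOverlap⇒∉ : ∀ {e a} → UniqueOverlap ALG e a → e ≢ a → e ∉ ALG
  uniqueOverlap⇒∉ {e} (_ , _ , only) e≢a e∈ALG = e≢a (only e∈ALG (overlap-refl e))

  uniqueOverlap⇒partner∉OPT : ∀ {e a} → e ∈ OPT → UniqueOverlap ALG e a → e ≢ a → a ∉ OPT
  uniqueOverlap⇒partner∉OPT {e} e∈OPT uo@(_ , _ , only) e≢a a∈OPT =
    cannotAdd e (∈OPT⇒E e∈OPT) e∉ALG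
      (++-consecutiveMatching {S = e ∷ []} consecutive cmOPT singleton⊆OPT (λ y∈ → y∈)
        (¬Any⇒All¬ _ e∉ALG ∷ proj₁ consecutive) overlap⇒∈OPT)
    where
    e∉ALG : e ∉ ALG
    e∉ALG = uniqueOverlap⇒∉ uo e≢a

    singleton⊆OPT : e ∷ [] ⊆ OPT
    singleton⊆OPT (here refl) = e∈OPT

    overlap⇒∈OPT : ∀ {x y} → x ∈ e ∷ [] → y ∈ ALG → Overlap x y → y ∈ OPT
    overlap⇒∈OPT (here refl) y∈ALG o = subst (_∈ OPT) (sym (only y∈ALG o)) a∈OPT

  sharedPartner⇒≡ : ∀ {e₁ e₂ a} → e₁ ∈ OPT → e₂ ∈ OPT →
                    UniqueOverlap ALG e₁ a → UniqueOverlap ALG e₂ a → e₁ ≢ a → e₂ ≢ a → e₁ ≡ e₂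
  sharedPartner⇒≡ {e₁} {e₂} {a} e₁∈OPT e₂∈OPT uo₁@(a∈ALG , _ , only₁) uo₂@(_ , _ , only₂) e₁≢a e₂≢a
    with e₁ ≟ₑ e₂
  ... | yes e₁≡e₂ = e₁≡e₂
  ... | no e₁≢e₂ with xs , ys , ALG≡ ← ∈-∃++ a∈ALG =
    ⊥-elim (cannotSwap e₁ e₂ a xs ys (∈OPT⇒E e₁∈OPT) (∈OPT⇒E e₂∈OPT) e₁∉ALG e₂∉ALG ALG≡
      (++-consecutiveMatching {S = e₁ ∷ e₂ ∷ []} consecutive cmOPT pair⊆OPT rest⊆ALG
        ((e₁≢e₂ ∷ ∉rest e₁∉ALG) ∷ ∉rest e₂∉ALG ∷ AllPairs.tail a∷rest-unique) overlap⇒∈OPT))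
    where
    e₁∉ALG : e₁ ∉ ALG
    e₁∉ALG = uniqueOverlap⇒∉ uo₁ e₁≢a

    e₂∉ALG : e₂ ∉ ALG
    e₂∉ALG = uniqueOverlap⇒∉ uo₂ e₂≢a

    σ : ALG ↭ a ∷ xs ++ ys
    σ = subst (_↭ a ∷ xs ++ ys) (sym ALG≡) (shift a xs ys)

    a∷rest-unique : Unique (a ∷ xs ++ ys)
    a∷rest-unique = Unique-resp-↭ σ (proj₁ consecutive)

    rest⊆ALG : xs ++ ys ⊆ ALG
    rest⊆ALG z∈ = ∈-resp-↭ (↭-sym σ) (there z∈)

    ∉rest : ∀ {e} → e ∉ ALG → All (e ≢_) (xs ++ ys)
    ∉rest e∉ALG = All.tabulate λ z∈ → λ { refl → e∉ALG (rest⊆ALG z∈) }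

    pair⊆OPT : e₁ ∷ e₂ ∷ [] ⊆ OPT
    pair⊆OPT (here refl) = e₁∈OPT
    pair⊆OPT (there (here refl)) = e₂∈OPT

    overlap⇒partner : ∀ {x y} → x ∈ e₁ ∷ e₂ ∷ [] → y ∈ ALG → Overlap x y → y ≡ a
    overlap⇒partner (here refl) = only₁
    overlap⇒partner (there (here refl)) = only₂

    -- The overlap would be with a, which was removed; so this case never occurs.
    overlap⇒∈OPT : ∀ {x y} → x ∈ e₁ ∷ e₂ ∷ [] → y ∈ xs ++ ys → Overlap x y → y ∈ OPT
    overlap⇒∈OPT x∈ y∈ o =
      ⊥-elim (All.lookup (AllPairs.head a∷rest-unique) y∈ (sym (overlap⇒partner x∈ (rest⊆ALG y∈) o)))

  uniqueOverlap-injective : ∀ {e₁ e₂ a} → e₁ ∈ OPT → e₂ ∈ OPT →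
                            UniqueOverlap ALG e₁ a → UniqueOverlap ALG e₂ a → e₁ ≡ e₂
  uniqueOverlap-injective {e₁} {e₂} {a} e₁∈OPT e₂∈OPT uo₁ uo₂ with e₁ ≟ₑ a | e₂ ≟ₑ a
  ... | yes e₁≡a | yes e₂≡a = trans e₁≡a (sym e₂≡a)
  ... | yes refl | no e₂≢a = ⊥-elim (uniqueOverlap⇒partner∉OPT e₂∈OPT uo₂ e₂≢a e₁∈OPT)
  ... | no e₁≢a | yes refl = ⊥-elim (uniqueOverlap⇒partner∉OPT e₁∈OPT uo₁ e₁≢a e₂∈OPT)
  ... | no e₁≢a | no e₂≢a = sharedPartner⇒≡ e₁∈OPT e₂∈OPT uo₁ uo₂ e₁≢a e₂≢a

  k₁≤length : k₁ ALG OPT ≤ length ALG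
  k₁≤length = injectiveRel⇒length≤ (UniqueOverlap ALG) (Unique.filter⁺ single? (proj₁ cmOPT)) partner
                (λ p q → uniqueOverlap-injective (proj₁ (∈single⁻ p)) (proj₁ (∈single⁻ q)))
    where
    single? : (e : Edge n) → Dec (overlapCount ALG e ≡ 1)
    single? e = overlapCount ALG e ≟ 1

    ∈single⁻ : ∀ {e} → e ∈ filter single? OPT → e ∈ OPT × overlapCount ALG e ≡ 1
    ∈single⁻ = ∈-filter⁻ single? {xs = OPT}

    partner : ∀ {e} → e ∈ filter single? OPT → ∃ λ a → a ∈ ALG × UniqueOverlap ALG e a
    partner {e} e∈ with a , uo ← length-filter≡1⇒∃! (overlap? e) (proj₂ (∈single⁻ e∈)) =
      a , proj₁ uo , uo

lemma2 : ∀ (n : ℕ) (E : Graph n) → NoThreeDiagonal E →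
         ∀ (ALG OPT : List (Edge n)) → Returns E ALG →
         MaximumConsecutiveMatching E OPT →
         k₁ ALG OPT ≤ length ALG
lemma2 n E _ ALG OPT returns (cmOPT , _) = k₁≤length (returns⇒locallyOptimal E returns) cmOPT
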